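{- Let $\alpha\geqslant1$ and $X\subseteq\mathbb{Z}_{2^\alpha}\setminus\{0\}$ with $X\cap(-X)=\emptyset$. Then $Dih(2^\alpha,X,X)$ is not a (genuine) directed strongly regular graph.
   Context: $D_n=\langle x,a\mid x^n=1,\ a^2=1,\ ax=x^{ -1}a\rangle$; $Dih(n,X,Y)$ is the Cayley digraph on $D_n$ with connection set $\{x^i:i\in X\}\cup\{x^ja:j\in Y\}$ (arc $g\to h$ iff $g^{ -1}h$ lies in it). A DSRG with parameters $(n,k,\mu,\lambda,t)$ is a digraph whose adjacency matrix $A$ satisfies $AJ=JA=kJ$, $A^2=tI+\lambda A+\mu(J-I-A)$; DSRGs are required to be genuine, i.e. $0<t<k$. -}

module Defs where

open import Data.Nat as ℕ using (ℕ; NonZero; _%_)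
open import Data.Nat.DivMod using (_mod_)
open import Data.Bool using (Bool; true; false; if_then_else_; _xor_)
open import Data.Fin using (Fin; toℕ)
open import Data.Fin.Subset using (Subset; _∈_; _∉_)
open import Data.Vec using (lookup)
open import Data.List using (List; []; _∷_; map; concatMap; length)
open import Data.List.Relation.Unary.Unique.Propositional using (Unique)
open import Data.List.Membership.Propositional renaming (_∈_ to _∈ₗ_)
open import Data.Integer as ℤ using (ℤ; +_; 0ℤ; 1ℤ)
open import Data.Product using (_×_; _,_)
import Data.Product.Properties
import Data.Fin
import Data.Bool
open import Relation.Nullary using (Dec; yes; no; ¬_)
open import Relation.Binary.Definitions using (DecidableEquality)
open import Relation.Binary.PropositionalEquality using (_≡_)

-- Directed strongly regular graphs, via the adjacency matrix.
-- A finite vertex type V is given by a duplicate-free list enumerating it.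

module _ {V : Set} (vs : List V) (_≟_ : DecidableEquality V)
         (A : V → V → ℤ) where

  Σᵥ : (V → ℤ) → ℤ
  Σᵥ f = Data.List.foldr (λ v s → f v ℤ.+ s) 0ℤ vs

  Iₘ : V → V → ℤ
  Iₘ g h with g ≟ h
  ... | yes _ = 1ℤ
  ... | no  _ = 0ℤ

  Jₘ : V → V → ℤ
  Jₘ _ _ = 1ℤ

  A² : V → V → ℤ
  A² g h = Σᵥ (λ w → A g w ℤ.* A w h)

  record IsDSRG (n k μ lam t : ℕ) : Set where
    field
      enumerates : ∀ v → v ∈ₗ vs
      distinct   : Unique vs
      order      : length vs ≡ n
      AJ≡kJ      : ∀ g h → Σᵥ (λ w → A g w ℤ.* Jₘ w h) ≡ + k ℤ.* Jₘ g h
      JA≡kJ      : ∀ g h → Σᵥ (λ w → Jₘ g w ℤ.* A w h) ≡ + k ℤ.* Jₘ g h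
      A²-eq      : ∀ g h → A² g h ≡
                     + t ℤ.* Iₘ g h ℤ.+ + lam ℤ.* A g h
                       ℤ.+ + μ ℤ.* (Jₘ g h ℤ.- Iₘ g h ℤ.- A g h)
      t>0        : 0 ℕ.< t
      t<k        : t ℕ.< k

  IsGenuineDSRG : Set
  IsGenuineDSRG = Data.Product.∃ λ n → Data.Product.∃ λ k →
    Data.Product.∃ λ μ → Data.Product.∃ λ lam → Data.Product.∃ λ t →
      IsDSRG n k μ lam t

-- The dihedral group D_n: the element x^i a^b is represented by (i , b).

module _ (n : ℕ) .{{_ : NonZero n}} where

  Dₙ : Set
  Dₙ = Fin n × Bool

  _⊖_ : Fin n → Fin n → Fin n
  i ⊖ j = (toℕ i ℕ.+ (n ℕ.∸ toℕ j)) mod n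

  negₙ : Fin n → Fin n
  negₙ i = (n ℕ.∸ toℕ i) mod n

  0ₙ : Fin n
  0ₙ = 0 mod n

  -- group product (x^i a^b)(x^j a^c) = x^{i + (-1)^b j} a^{b+c}
  _·_ : Dₙ → Dₙ → Dₙ
  (i , false) · (j , c) = ((toℕ i ℕ.+ toℕ j) mod n , c)
  (i , true)  · (j , c) = (i ⊖ j , true xor c)

  inv : Dₙ → Dₙ
  inv (i , false) = (negₙ i , false)
  inv (i , true)  = (i , true)

  Dₙ-list : List Dₙ
  Dₙ-list = concatMap (λ i → (i , false) ∷ (i , true) ∷ []) (Data.List.allFin n)

  Dₙ-≟ : DecidableEquality Dₙ
  Dₙ-≟ = Data.Product.Properties.≡-dec Data.Fin._≟_ Data.Bool._≟_

  inConn : Subset n → Subset n → Dₙ → Bool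
  inConn X Y (i , false) = lookup X i
  inConn X Y (j , true)  = lookup Y j

  Dih : Subset n → Subset n → Dₙ → Dₙ → ℤ
  Dih X Y g h = if inConn X Y (inv g · h) then 1ℤ else 0ℤ

  DihIsDSRG : Subset n → Subset n → Set
  DihIsDSRG X Y = IsGenuineDSRG Dₙ-list Dₙ-≟ (Dih X Y)

-- The 2-paths from e to a reflection x^g a run through x^i (when g − i ∈ X) or through
-- x^i a (when i − g ∈ X), for i ∈ X.  As X ∩ (−X) = ∅, each i ∈ X contributes at most one
-- such path, and for g = 0 exactly one.  For g ∉ X (g = 0 included) the pair (e, x^g a)
-- is a non-arc, so the DSRG equation makes the number of these paths μ, independently of
-- g; hence every i ∈ X contributes, and g = −y with y ∈ X gives 2y ∈ X or −2y ∈ X.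
-- Starting from some x ∈ X (X ≠ ∅ as k > t > 0) this puts ±2^α x = 0 into X.

module Submission where

open import Defs
open import Data.Bool using (Bool; true; false; if_then_else_)
open import Data.Fin using (Fin; toℕ)
import Data.Fin.Properties as FP
open import Data.Fin.Subset using (Subset; _∈_; _∉_; Nonempty)
open import Data.Fin.Subset.Properties using (nonempty?)
open import Data.Integer as ℤ using (ℤ; +_; 0ℤ; 1ℤ; _-_; -_; ∣_∣)
import Data.Integer.Properties as ℤP
open import Data.Integer.Divisibility.Signed
  using (_∣_; divides; ∣⇒∣ᵤ; ∣m∣n⇒∣m+n; ∣m⇒∣-m; ∣n⇒∣m*n; ∣m⇒∣m*n; ∣-refl)
open import Data.Integer.Tactic.RingSolver using (solve-∀)
open import Data.List using (List; []; _∷_; map; foldr; concatMap; allFin)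
open import Data.List.Properties using (map-cong)
open import Data.List.Relation.Unary.Any using (here; there)
open import Data.List.Membership.Propositional using () renaming (_∈_ to _∈ₗ_)
open import Data.List.Membership.Propositional.Properties using (∈-allFin)
open import Data.Nat as ℕ using (ℕ; NonZero; _%_; _/_; _≤_; _<_; _^_)
open import Data.Nat.DivMod using (_mod_; m≡m%n+[m/n]*n; m%n<n; m<n⇒m%n≡m)
open import Data.Nat.Divisibility using (n∣m⇒m%n≡0)
open import Data.Nat.ListAction using (sum)
open import Data.Nat.Properties using (m^n≢0)
import Data.Nat.Properties as ℕP
open import Data.Product using (∃; _×_; _,_; proj₁; proj₂)
open import Data.Sum using (_⊎_; inj₁; inj₂; [_,_]′)
open import Data.Vec using (lookup)
import Data.Vec.Properties as VP
open import Function using (_∘′_)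
open import Relation.Binary.Bundles using (Setoid)
open import Relation.Binary.Definitions using (DecidableEquality)
open import Relation.Binary.PropositionalEquality
  using (_≡_; _≢_; refl; sym; trans; cong; cong₂; subst; module ≡-Reasoning)
open import Relation.Binary.Structures using (IsEquivalence)
open import Relation.Nullary using (¬_; yes; no; contradiction)

module Congruence (n : ℕ) where

  infix 4 _≈_ _≈±_

  record _≈_ (a b : ℤ) : Set where
    constructor congruent
    field n∣a-b : + n ∣ a - b

  _≈±_ : ℤ → ℤ → Set
  a ≈± b = a ≈ b ⊎ a ≈ - b

  private
    ≈-from-∣ : ∀ {a b x} → x ≡ a - b → + n ∣ x → a ≈ b
    ≈-from-∣ eq n∣x = congruent (subst (+ n ∣_) eq n∣x)

  ≈-reflexive : ∀ {a b} → a ≡ b → a ≈ b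
  ≈-reflexive {a} refl = congruent (divides 0ℤ (trans (ℤP.+-inverseʳ a) (sym (ℤP.*-zeroˡ (+ n)))))

  ≈-sym : ∀ {a b} → a ≈ b → b ≈ a
  ≈-sym {a} {b} (congruent p) = ≈-from-∣ (eq a b) (∣m⇒∣-m p)
    where eq : ∀ a b → - (a - b) ≡ b - a
          eq = solve-∀

  ≈-trans : ∀ {a b c} → a ≈ b → b ≈ c → a ≈ c
  ≈-trans {a} {b} {c} (congruent p) (congruent q) = ≈-from-∣ (eq a b c) (∣m∣n⇒∣m+n p q)
    where eq : ∀ a b c → (a - b) ℤ.+ (b - c) ≡ a - c
          eq = solve-∀

  ≈-isEquivalence : IsEquivalence _≈_
  ≈-isEquivalence = record
    { refl = ≈-reflexive refl ; sym = ≈-sym ; trans = ≈-trans }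

  ≈-setoid : Setoid _ _
  ≈-setoid = record { isEquivalence = ≈-isEquivalence }

  +-cong : ∀ {a b c d} → a ≈ b → c ≈ d → a ℤ.+ c ≈ b ℤ.+ d
  +-cong {a} {b} {c} {d} (congruent p) (congruent q) = ≈-from-∣ (eq a b c d) (∣m∣n⇒∣m+n p q)
    where eq : ∀ a b c d → (a - b) ℤ.+ (c - d) ≡ (a ℤ.+ c) - (b ℤ.+ d)
          eq = solve-∀

  +-congˡ : ∀ a {c d} → c ≈ d → a ℤ.+ c ≈ a ℤ.+ d
  +-congˡ a = +-cong (≈-reflexive {a} refl)

  +-congʳ : ∀ c {a b} → a ≈ b → a ℤ.+ c ≈ b ℤ.+ c
  +-congʳ c a≈b = +-cong a≈b (≈-reflexive {c} refl)

  neg-cong : ∀ {a b} → a ≈ b → - a ≈ - b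
  neg-cong {a} {b} (congruent p) = ≈-from-∣ (eq a b) (∣m⇒∣-m p)
    where eq : ∀ a b → - (a - b) ≡ - a - - b
          eq = solve-∀

  *-congˡ : ∀ c {a b} → a ≈ b → c ℤ.* a ≈ c ℤ.* b
  *-congˡ c {a} {b} (congruent p) = ≈-from-∣ (eq c a b) (∣n⇒∣m*n c p)
    where eq : ∀ c a b → c ℤ.* (a - b) ≡ c ℤ.* a - c ℤ.* b
          eq = solve-∀

  ≈±-trans : ∀ {a b c} → a ≈± b → b ≈± c → a ≈± c
  ≈±-trans (inj₁ a≈b)  (inj₁ b≈c)  = inj₁ (≈-trans a≈b b≈c)
  ≈±-trans (inj₁ a≈b)  (inj₂ b≈-c) = inj₂ (≈-trans a≈b b≈-c)
  ≈±-trans (inj₂ a≈-b) (inj₁ b≈c)  = inj₂ (≈-trans a≈-b (neg-cong b≈c))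
  ≈±-trans {c = c} (inj₂ a≈-b) (inj₂ b≈-c) =
    inj₁ (≈-trans a≈-b (≈-trans (neg-cong b≈-c) (≈-reflexive (ℤP.neg-involutive c))))

  ≈±-≈0 : ∀ {a b} → a ≈± b → b ≈ 0ℤ → a ≈ 0ℤ
  ≈±-≈0 (inj₁ a≈b)  b≈0 = ≈-trans a≈b b≈0
  ≈±-≈0 (inj₂ a≈-b) b≈0 = ≈-trans a≈-b (neg-cong b≈0)

  ≈±-*-congˡ : ∀ c {a b} → a ≈± b → c ℤ.* a ≈± c ℤ.* b
  ≈±-*-congˡ c (inj₁ a≈b)  = inj₁ (*-congˡ c a≈b)
  ≈±-*-congˡ c {b = b} (inj₂ a≈-b) =
    inj₂ (≈-trans (*-congˡ c a≈-b) (≈-reflexive (sym (ℤP.neg-distribʳ-* c b))))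

  n*a≈0 : ∀ a → + n ℤ.* a ≈ 0ℤ
  n*a≈0 a = ≈-from-∣ (sym (ℤP.+-identityʳ (+ n ℤ.* a))) (∣m⇒∣m*n a ∣-refl)

  n∸k≈-k : ∀ {k} → k ≤ n → + (n ℕ.∸ k) ≈ - + k
  n∸k≈-k {k} k≤n = congruent (divides 1ℤ (begin
    + (n ℕ.∸ k) - - + k      ≡⟨ cong (ℤ._+_ (+ (n ℕ.∸ k))) (ℤP.neg-involutive (+ k)) ⟩
    + (n ℕ.∸ k) ℤ.+ + k      ≡⟨ ℤP.pos-+ (n ℕ.∸ k) k ⟨
    + (n ℕ.∸ k ℕ.+ k)        ≡⟨ cong +_ (ℕP.m∸n+n≡m k≤n) ⟩
    + n                      ≡⟨ ℤP.*-identityˡ (+ n) ⟨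
    1ℤ ℤ.* + n               ∎))
    where open ≡-Reasoning

  module _ .{{_ : NonZero n}} where

    m%n≈m : ∀ m → + (m % n) ≈ + m
    m%n≈m m = ≈-sym (congruent (divides (+ (m / n)) (begin
      + m - + (m % n)                           ≡⟨ cong (λ x → + x - + (m % n)) (m≡m%n+[m/n]*n m n) ⟩
      + (m % n ℕ.+ m / n ℕ.* n) - + (m % n)     ≡⟨ cong (_- + (m % n)) (ℤP.pos-+ (m % n) (m / n ℕ.* n)) ⟩
      + (m % n) ℤ.+ + (m / n ℕ.* n) - + (m % n) ≡⟨ cancel (+ (m % n)) (+ (m / n ℕ.* n)) ⟩
      + (m / n ℕ.* n)                           ≡⟨ ℤP.pos-* (m / n) n ⟩
      + (m / n) ℤ.* + n                         ∎)))
      where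
        open ≡-Reasoning
        cancel : ∀ r s → r ℤ.+ s - r ≡ s
        cancel = solve-∀

    -- |a - b| < n is a multiple of n, hence 0
    ≈⇒≡ : ∀ {a b} → a < n → b < n → + a ≈ + b → a ≡ b
    ≈⇒≡ {a} {b} a<n b<n (congruent n∣a-b) = ℤP.+-injective (ℤP.i-j≡0⇒i≡j (+ a) (+ b) (ℤP.∣i∣≡0⇒i≡0 ∣a-b∣≡0))
      where
        ∣a-b∣<n : ∣ + a - + b ∣ < n
        ∣a-b∣<n = ℕP.≤-<-trans (subst (ℕ._≤ a ℕ.⊔ b) (cong ∣_∣ (sym (ℤP.m-n≡m⊖n a b))) (ℤP.∣m⊝n∣≤m⊔n a b))
                               (ℕP.⊔-pres-<m a<n b<n)
        ∣a-b∣≡0 : ∣ + a - + b ∣ ≡ 0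
        ∣a-b∣≡0 = trans (sym (m<n⇒m%n≡m ∣a-b∣<n)) (n∣m⇒m%n≡0 _ n (∣⇒∣ᵤ n∣a-b))

module Residues (n : ℕ) .{{_ : NonZero n}} where

  open Congruence n
  open import Relation.Binary.Reasoning.Setoid ≈-setoid

  ⟦_⟧ : Fin n → ℤ
  ⟦ i ⟧ = + toℕ i

  infixl 6 _+ₙ_
  _+ₙ_ : Fin n → Fin n → Fin n
  i +ₙ j = (toℕ i ℕ.+ toℕ j) mod n

  ⟦⟧-injective : ∀ {i j} → ⟦ i ⟧ ≈ ⟦ j ⟧ → i ≡ j
  ⟦⟧-injective {i} {j} = FP.toℕ-injective ∘′ ≈⇒≡ (FP.toℕ<n i) (FP.toℕ<n j)

  ⟦mod⟧ : ∀ m → ⟦ m mod n ⟧ ≈ + m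
  ⟦mod⟧ m = ≈-trans (≈-reflexive (cong +_ (FP.toℕ-fromℕ< (m%n<n m n)))) (m%n≈m m)

  ⟦0ₙ⟧ : ⟦ 0ₙ n ⟧ ≈ 0ℤ
  ⟦0ₙ⟧ = ⟦mod⟧ 0

  ⟦negₙ⟧ : ∀ i → ⟦ negₙ n i ⟧ ≈ - ⟦ i ⟧
  ⟦negₙ⟧ i = ≈-trans (⟦mod⟧ (n ℕ.∸ toℕ i)) (n∸k≈-k (ℕP.<⇒≤ (FP.toℕ<n i)))

  ⟦+ₙ⟧ : ∀ i j → ⟦ i +ₙ j ⟧ ≈ ⟦ i ⟧ ℤ.+ ⟦ j ⟧
  ⟦+ₙ⟧ i j = ≈-trans (⟦mod⟧ (toℕ i ℕ.+ toℕ j)) (≈-reflexive (ℤP.pos-+ (toℕ i) (toℕ j)))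

  ⟦⊖⟧ : ∀ i j → ⟦ _⊖_ n i j ⟧ ≈ ⟦ i ⟧ - ⟦ j ⟧
  ⟦⊖⟧ i j = begin
    ⟦ _⊖_ n i j ⟧                       ≈⟨ ⟦mod⟧ (toℕ i ℕ.+ (n ℕ.∸ toℕ j)) ⟩
    + (toℕ i ℕ.+ (n ℕ.∸ toℕ j))         ≡⟨ ℤP.pos-+ (toℕ i) _ ⟩
    ⟦ i ⟧ ℤ.+ + (n ℕ.∸ toℕ j)           ≈⟨ +-congˡ ⟦ i ⟧ (n∸k≈-k (ℕP.<⇒≤ (FP.toℕ<n j))) ⟩
    ⟦ i ⟧ - ⟦ j ⟧                       ∎

  -ₙ0ₙ+ₙi≡i : ∀ i → negₙ n (0ₙ n) +ₙ i ≡ i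
  -ₙ0ₙ+ₙi≡i i = ⟦⟧-injective (begin
    ⟦ negₙ n (0ₙ n) +ₙ i ⟧         ≈⟨ ⟦+ₙ⟧ (negₙ n (0ₙ n)) i ⟩
    ⟦ negₙ n (0ₙ n) ⟧ ℤ.+ ⟦ i ⟧     ≈⟨ +-congʳ ⟦ i ⟧ (≈-trans (⟦negₙ⟧ (0ₙ n)) (neg-cong ⟦0ₙ⟧)) ⟩
    0ℤ ℤ.+ ⟦ i ⟧                   ≡⟨ ℤP.+-identityˡ ⟦ i ⟧ ⟩
    ⟦ i ⟧                          ∎)

  -ₙi+ₙ0ₙ≡-ₙi : ∀ i → negₙ n i +ₙ 0ₙ n ≡ negₙ n i
  -ₙi+ₙ0ₙ≡-ₙi i = ⟦⟧-injective (begin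
    ⟦ negₙ n i +ₙ 0ₙ n ⟧           ≈⟨ ⟦+ₙ⟧ (negₙ n i) (0ₙ n) ⟩
    ⟦ negₙ n i ⟧ ℤ.+ ⟦ 0ₙ n ⟧      ≈⟨ +-congˡ ⟦ negₙ n i ⟧ ⟦0ₙ⟧ ⟩
    ⟦ negₙ n i ⟧ ℤ.+ 0ℤ            ≡⟨ ℤP.+-identityʳ ⟦ negₙ n i ⟧ ⟩
    ⟦ negₙ n i ⟧                   ∎)

  i⊖0ₙ≡i : ∀ i → _⊖_ n i (0ₙ n) ≡ i
  i⊖0ₙ≡i i = ⟦⟧-injective (begin
    ⟦ _⊖_ n i (0ₙ n) ⟧    ≈⟨ ⟦⊖⟧ i (0ₙ n) ⟩
    ⟦ i ⟧ - ⟦ 0ₙ n ⟧      ≈⟨ +-congˡ ⟦ i ⟧ (neg-cong ⟦0ₙ⟧) ⟩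
    ⟦ i ⟧ ℤ.+ 0ℤ          ≡⟨ ℤP.+-identityʳ ⟦ i ⟧ ⟩
    ⟦ i ⟧                 ∎)

  i⊖j≡-ₙ[-ₙi+ₙj] : ∀ i j → _⊖_ n i j ≡ negₙ n (negₙ n i +ₙ j)
  i⊖j≡-ₙ[-ₙi+ₙj] i j = ⟦⟧-injective (begin
    ⟦ _⊖_ n i j ⟧                     ≈⟨ ⟦⊖⟧ i j ⟩
    ⟦ i ⟧ - ⟦ j ⟧                     ≡⟨ eq ⟦ i ⟧ ⟦ j ⟧ ⟩
    - (- ⟦ i ⟧ ℤ.+ ⟦ j ⟧)             ≈⟨ neg-cong (+-congʳ ⟦ j ⟧ (⟦negₙ⟧ i)) ⟨
    - (⟦ negₙ n i ⟧ ℤ.+ ⟦ j ⟧)        ≈⟨ neg-cong (⟦+ₙ⟧ (negₙ n i) j) ⟨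
    - ⟦ negₙ n i +ₙ j ⟧               ≈⟨ ⟦negₙ⟧ (negₙ n i +ₙ j) ⟨
    ⟦ negₙ n (negₙ n i +ₙ j) ⟧        ∎)
    where eq : ∀ a b → a - b ≡ - (- a ℤ.+ b)
          eq = solve-∀

  ⟦-ₙi+ₙ-ₙi⟧ : ∀ i → ⟦ negₙ n i +ₙ negₙ n i ⟧ ≈ - (+ 2 ℤ.* ⟦ i ⟧)
  ⟦-ₙi+ₙ-ₙi⟧ i = begin
    ⟦ negₙ n i +ₙ negₙ n i ⟧          ≈⟨ ⟦+ₙ⟧ (negₙ n i) (negₙ n i) ⟩
    ⟦ negₙ n i ⟧ ℤ.+ ⟦ negₙ n i ⟧     ≈⟨ +-cong (⟦negₙ⟧ i) (⟦negₙ⟧ i) ⟩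
    - ⟦ i ⟧ ℤ.+ - ⟦ i ⟧               ≡⟨ eq ⟦ i ⟧ ⟩
    - (+ 2 ℤ.* ⟦ i ⟧)                 ∎
    where eq : ∀ a → - a ℤ.+ - a ≡ - (+ 2 ℤ.* a)
          eq = solve-∀

  ⟦i⊖-ₙi⟧ : ∀ i → ⟦ _⊖_ n i (negₙ n i) ⟧ ≈ + 2 ℤ.* ⟦ i ⟧
  ⟦i⊖-ₙi⟧ i = begin
    ⟦ _⊖_ n i (negₙ n i) ⟧     ≈⟨ ⟦⊖⟧ i (negₙ n i) ⟩
    ⟦ i ⟧ - ⟦ negₙ n i ⟧       ≈⟨ +-congˡ ⟦ i ⟧ (neg-cong (⟦negₙ⟧ i)) ⟩
    ⟦ i ⟧ - - ⟦ i ⟧            ≡⟨ eq ⟦ i ⟧ ⟩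
    + 2 ℤ.* ⟦ i ⟧              ∎
    where eq : ∀ a → a - - a ≡ + 2 ℤ.* a
          eq = solve-∀

sum-mono-≤ : ∀ {A : Set} {f g : A → ℕ} → (∀ x → f x ≤ g x) → ∀ xs → sum (map f xs) ≤ sum (map g xs)
sum-mono-≤ f≤g []       = ℕP.≤-refl
sum-mono-≤ f≤g (x ∷ xs) = ℕP.+-mono-≤ (f≤g x) (sum-mono-≤ f≤g xs)

+-mono-≤-≡⇒≡ : ∀ {a b c d} → a ≤ c → b ≤ d → a ℕ.+ b ≡ c ℕ.+ d → a ≡ c × b ≡ d
+-mono-≤-≡⇒≡ {a} {b} {c} {d} a≤c b≤d a+b≡c+d = a≡c , ℕP.+-cancelˡ-≡ c b d (trans (cong (ℕ._+ b) (sym a≡c)) a+b≡c+d)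
  where
    a≡c : a ≡ c
    a≡c = ℕP.≤-antisym a≤c (ℕP.+-cancelʳ-≤ d c a (ℕP.≤-trans (ℕP.≤-reflexive (sym a+b≡c+d)) (ℕP.+-monoʳ-≤ a b≤d)))

sum-≡⇒pointwise-≡ : ∀ {A : Set} {f g : A → ℕ} → (∀ x → f x ≤ g x) →
                    ∀ xs → sum (map f xs) ≡ sum (map g xs) → ∀ {x} → x ∈ₗ xs → f x ≡ g x
sum-≡⇒pointwise-≡ f≤g (y ∷ ys) Σ≡ (here refl)  = proj₁ (+-mono-≤-≡⇒≡ (f≤g y) (sum-mono-≤ f≤g ys) Σ≡)
sum-≡⇒pointwise-≡ f≤g (y ∷ ys) Σ≡ (there x∈ys) =
  sum-≡⇒pointwise-≡ f≤g ys (proj₂ (+-mono-≤-≡⇒≡ (f≤g y) (sum-mono-≤ f≤g ys) Σ≡)) x∈ys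

Σ-zero : ∀ {V : Set} (f : V → ℤ) → (∀ v → f v ≡ 0ℤ) → ∀ vs → foldr (λ v s → f v ℤ.+ s) 0ℤ vs ≡ 0ℤ
Σ-zero f f≡0 []       = refl
Σ-zero f f≡0 (v ∷ vs) = cong₂ ℤ._+_ (f≡0 v) (Σ-zero f f≡0 vs)

module _ {V : Set} {vs : List V} {_≟_ : DecidableEquality V} {A : V → V → ℤ}
         {N k μ lam t : ℕ} (dsrg : IsDSRG vs _≟_ A N k μ lam t) where

  open IsDSRG dsrg

  A²-nonadjacent : ∀ {g h} → Iₘ vs _≟_ A g h ≡ 0ℤ → A g h ≡ 0ℤ → A² vs _≟_ A g h ≡ + μ
  A²-nonadjacent {g} {h} Igh≡0 Agh≡0 = begin
    A² vs _≟_ A g h   ≡⟨ A²-eq g h ⟩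
    rhs (Iₘ vs _≟_ A g h) (A g h)   ≡⟨ cong₂ rhs Igh≡0 Agh≡0 ⟩
    rhs 0ℤ 0ℤ   ≡⟨ simplify (+ t) (+ lam) (+ μ) ⟩
    + μ   ∎
    where
      open ≡-Reasoning
      rhs : ℤ → ℤ → ℤ
      rhs i a = + t ℤ.* i ℤ.+ + lam ℤ.* a ℤ.+ + μ ℤ.* (1ℤ - i - a)
      simplify : ∀ t l m → t ℤ.* 0ℤ ℤ.+ l ℤ.* 0ℤ ℤ.+ m ℤ.* (1ℤ - 0ℤ - 0ℤ) ≡ m
      simplify = solve-∀

  row-nonzero : ∀ g → ¬ (∀ w → A g w ≡ 0ℤ)
  row-nonzero g row≡0 = ℕP.<⇒≢ (ℕP.<-trans t>0 t<k) (sym (ℤP.+-injective k≡0))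
    where
      k≡0 : + k ≡ 0ℤ
      k≡0 = begin
        + k                         ≡⟨ ℤP.*-identityʳ (+ k) ⟨
        + k ℤ.* 1ℤ                  ≡⟨ AJ≡kJ g g ⟨
        Σᵥ vs _≟_ A (λ w → A g w ℤ.* 1ℤ) ≡⟨ Σ-zero _ (λ w → cong (ℤ._* 1ℤ) (row≡0 w)) vs ⟩
        0ℤ                          ∎
        where open ≡-Reasoning

𝟙 : Bool → ℕ
𝟙 true  = 1
𝟙 false = 0

if-1-0≡+𝟙 : ∀ b → (if b then 1ℤ else 0ℤ) ≡ + 𝟙 b
if-1-0≡+𝟙 true  = refl
if-1-0≡+𝟙 false = refl

𝟙+𝟙≡1⇒≡true : ∀ a b → 𝟙 a ℕ.+ 𝟙 b ≡ 1 → a ≡ true ⊎ b ≡ true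
𝟙+𝟙≡1⇒≡true true  _     _ = inj₁ refl
𝟙+𝟙≡1⇒≡true false true  _ = inj₂ refl

module DihedralCayley (n : ℕ) .{{_ : NonZero n}} (X : Subset n) where

  open Congruence n
  open Residues n

  A : Dₙ n → Dₙ n → ℤ
  A = Dih n X X

  e : Dₙ n
  e = (0ₙ n , false)

  ∈⇒lookup≡true : ∀ {i} → i ∈ X → lookup X i ≡ true
  ∈⇒lookup≡true = VP.[]=⇒lookup

  lookup≡true⇒∈ : ∀ {i} → lookup X i ≡ true → i ∈ X
  lookup≡true⇒∈ {i} = VP.lookup⇒[]= i X

  ∉⇒lookup≡false : ∀ {i} → i ∉ X → lookup X i ≡ false
  ∉⇒lookup≡false {i} i∉X with lookup X i in eq
  ... | true  = contradiction (lookup≡true⇒∈ eq) i∉X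
  ... | false = refl

  A-e : ∀ i c → A e (i , c) ≡ + 𝟙 (lookup X i)
  A-e i false = trans (cong (λ j → if lookup X j then 1ℤ else 0ℤ) (-ₙ0ₙ+ₙi≡i i)) (if-1-0≡+𝟙 (lookup X i))
  A-e i true  = trans (cong (λ j → if lookup X j then 1ℤ else 0ℤ) (-ₙ0ₙ+ₙi≡i i)) (if-1-0≡+𝟙 (lookup X i))

  Iₘ-e-reflection : ∀ g → Iₘ (Dₙ-list n) (Dₙ-≟ n) A e (g , true) ≡ 0ℤ
  Iₘ-e-reflection g with Dₙ-≟ n e (g , true)
  ... | yes e≡ga = contradiction (cong proj₂ e≡ga) λ ()
  ... | no _     = refl

  -- the number of paths e → x^i → x^g a and e → x^i a → x^g a
  twoPaths : Fin n → Fin n → ℕ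
  twoPaths g i = 𝟙 (lookup X i) ℕ.* (𝟙 (lookup X (negₙ n i +ₙ g)) ℕ.+ 𝟙 (lookup X (_⊖_ n i g)))

  twoPaths-via : ∀ g i → A e (i , false) ℤ.* A (i , false) (g , true) ℤ.+ A e (i , true) ℤ.* A (i , true) (g , true)
                         ≡ + twoPaths g i
  twoPaths-via g i = begin
    A e (i , false) ℤ.* A (i , false) (g , true) ℤ.+ A e (i , true) ℤ.* A (i , true) (g , true)
      ≡⟨ cong₂ (λ x y → x ℤ.* A (i , false) (g , true) ℤ.+ y ℤ.* A (i , true) (g , true)) (A-e i false) (A-e i true) ⟩
    + a ℤ.* A (i , false) (g , true) ℤ.+ + a ℤ.* A (i , true) (g , true)
      ≡⟨ cong₂ (λ x y → + a ℤ.* x ℤ.+ + a ℤ.* y) (if-1-0≡+𝟙 (lookup X (negₙ n i +ₙ g))) (if-1-0≡+𝟙 (lookup X (_⊖_ n i g))) ⟩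
    + a ℤ.* + b ℤ.+ + a ℤ.* + c   ≡⟨ ℤP.*-distribˡ-+ (+ a) (+ b) (+ c) ⟨
    + a ℤ.* (+ b ℤ.+ + c)         ≡⟨ cong (+ a ℤ.*_) (ℤP.pos-+ b c) ⟨
    + a ℤ.* + (b ℕ.+ c)           ≡⟨ ℤP.pos-* a (b ℕ.+ c) ⟨
    + twoPaths g i                ∎
    where
      open ≡-Reasoning
      a = 𝟙 (lookup X i)
      b = 𝟙 (lookup X (negₙ n i +ₙ g))
      c = 𝟙 (lookup X (_⊖_ n i g))

  Σ-Dₙ : ∀ (f : Dₙ n → ℤ) (F : Fin n → ℕ) → (∀ i → f (i , false) ℤ.+ f (i , true) ≡ + F i) → ∀ L →
         foldr (λ v s → f v ℤ.+ s) 0ℤ (concatMap (λ i → (i , false) ∷ (i , true) ∷ []) L) ≡ + sum (map F L)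
  Σ-Dₙ f F f≡F []      = refl
  Σ-Dₙ f F f≡F (i ∷ L) = begin
    f (i , false) ℤ.+ (f (i , true) ℤ.+ Σf)   ≡⟨ ℤP.+-assoc (f (i , false)) (f (i , true)) Σf ⟨
    f (i , false) ℤ.+ f (i , true) ℤ.+ Σf     ≡⟨ cong₂ ℤ._+_ (f≡F i) (Σ-Dₙ f F f≡F L) ⟩
    + F i ℤ.+ + sum (map F L)                 ≡⟨ ℤP.pos-+ (F i) _ ⟨
    + sum (map F (i ∷ L))                     ∎
    where
      open ≡-Reasoning
      Σf = foldr (λ v s → f v ℤ.+ s) 0ℤ (concatMap (λ i → (i , false) ∷ (i , true) ∷ []) L)

  A²-e-reflection : ∀ g → A² (Dₙ-list n) (Dₙ-≟ n) A e (g , true) ≡ + sum (map (twoPaths g) (allFin n))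
  A²-e-reflection g = Σ-Dₙ (λ w → A e w ℤ.* A w (g , true)) (twoPaths g) (twoPaths-via g) (allFin n)

  module _ {N k μ lam t : ℕ} (dsrg : IsDSRG (Dₙ-list n) (Dₙ-≟ n) A N k μ lam t) where

    X-nonempty : Nonempty X
    X-nonempty with nonempty? X
    ... | yes ne = ne
    ... | no  ¬ne = contradiction row-e≡0 (row-nonzero dsrg e)
      where
        row-e≡0 : ∀ w → A e w ≡ 0ℤ
        row-e≡0 (i , c) = trans (A-e i c) (cong (+_ ∘′ 𝟙) (∉⇒lookup≡false (λ i∈X → ¬ne (i , i∈X))))

  module _ (X∩-X≡∅ : ∀ i → i ∈ X → negₙ n i ∉ X) where

    lookup-negₙ≡false : ∀ {j} → lookup X j ≡ true → lookup X (negₙ n j) ≡ false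
    lookup-negₙ≡false {j} eq = ∉⇒lookup≡false (X∩-X≡∅ j (lookup≡true⇒∈ eq))

    𝟙+𝟙∘negₙ≤1 : ∀ j → 𝟙 (lookup X j) ℕ.+ 𝟙 (lookup X (negₙ n j)) ≤ 1
    𝟙+𝟙∘negₙ≤1 j with lookup X j in eq
    ... | false = 𝟙≤1 (lookup X (negₙ n j))
      where 𝟙≤1 : ∀ b → 𝟙 b ≤ 1
            𝟙≤1 true  = ℕP.≤-refl
            𝟙≤1 false = ℕ.z≤n
    ... | true = subst (λ b → 1 ℕ.+ 𝟙 b ≤ 1) (sym (lookup-negₙ≡false eq)) ℕP.≤-refl

    twoPaths≤ : ∀ g i → twoPaths g i ≤ 𝟙 (lookup X i)
    twoPaths≤ g i = ℕP.≤-trans (ℕP.*-monoʳ-≤ (𝟙 (lookup X i)) paths≤1) (ℕP.≤-reflexive (ℕP.*-identityʳ (𝟙 (lookup X i))))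
      where
        paths≤1 : 𝟙 (lookup X (negₙ n i +ₙ g)) ℕ.+ 𝟙 (lookup X (_⊖_ n i g)) ≤ 1
        paths≤1 = subst (λ j → 𝟙 (lookup X (negₙ n i +ₙ g)) ℕ.+ 𝟙 (lookup X j) ≤ 1)
                        (sym (i⊖j≡-ₙ[-ₙi+ₙj] i g)) (𝟙+𝟙∘negₙ≤1 (negₙ n i +ₙ g))

    twoPaths-0ₙ : ∀ i → twoPaths (0ₙ n) i ≡ 𝟙 (lookup X i)
    twoPaths-0ₙ i = trans (cong₂ (λ j k → 𝟙 (lookup X i) ℕ.* (𝟙 (lookup X j) ℕ.+ 𝟙 (lookup X k)))
                                 (-ₙi+ₙ0ₙ≡-ₙi i) (i⊖0ₙ≡i i))
                          (paths-from-i (lookup X i) refl)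
      where
        paths-from-i : ∀ b → lookup X i ≡ b → 𝟙 b ℕ.* (𝟙 (lookup X (negₙ n i)) ℕ.+ 𝟙 b) ≡ 𝟙 b
        paths-from-i false _  = refl
        paths-from-i true  eq = cong (λ b → 𝟙 b ℕ.+ 1 ℕ.+ 0) (lookup-negₙ≡false eq)

    twoPaths-∈ : ∀ {g i} → i ∈ X → twoPaths g i ≡ 𝟙 (lookup X (negₙ n i +ₙ g)) ℕ.+ 𝟙 (lookup X (_⊖_ n i g))
    twoPaths-∈ {g} {i} i∈X = trans (cong (λ b → 𝟙 b ℕ.* paths) (∈⇒lookup≡true i∈X)) (ℕP.*-identityˡ paths)
      where paths = 𝟙 (lookup X (negₙ n i +ₙ g)) ℕ.+ 𝟙 (lookup X (_⊖_ n i g))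

    module _ (0∉X : 0ₙ n ∉ X) {N k μ lam t : ℕ} (dsrg : IsDSRG (Dₙ-list n) (Dₙ-≟ n) A N k μ lam t) where

      Σ-twoPaths≡μ : ∀ g → g ∉ X → sum (map (twoPaths g) (allFin n)) ≡ μ
      Σ-twoPaths≡μ g g∉X = ℤP.+-injective (trans (sym (A²-e-reflection g))
        (A²-nonadjacent dsrg (Iₘ-e-reflection g) (trans (A-e g true) (cong (+_ ∘′ 𝟙) (∉⇒lookup≡false g∉X)))))

      -- Both sums equal μ, and the pointwise bound twoPaths≤ is attained at g = 0.
      twoPaths-saturated : ∀ g → g ∉ X → ∀ i → twoPaths g i ≡ 𝟙 (lookup X i)
      twoPaths-saturated g g∉X i = sum-≡⇒pointwise-≡ (twoPaths≤ g) (allFin n) Σ≡ (∈-allFin i)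
        where
          Σ≡ : sum (map (twoPaths g) (allFin n)) ≡ sum (map (𝟙 ∘′ lookup X) (allFin n))
          Σ≡ = trans (Σ-twoPaths≡μ g g∉X)
                 (trans (sym (Σ-twoPaths≡μ (0ₙ n) 0∉X)) (cong sum (map-cong twoPaths-0ₙ (allFin n))))

      ±2y∈X : ∀ {y} → y ∈ X → lookup X (negₙ n y +ₙ negₙ n y) ≡ true ⊎ lookup X (_⊖_ n y (negₙ n y)) ≡ true
      ±2y∈X {y} y∈X = 𝟙+𝟙≡1⇒≡true _ _ (begin
        𝟙 (lookup X (negₙ n y +ₙ negₙ n y)) ℕ.+ 𝟙 (lookup X (_⊖_ n y (negₙ n y))) ≡⟨ twoPaths-∈ y∈X ⟨
        twoPaths (negₙ n y) y                                                   ≡⟨ twoPaths-saturated (negₙ n y) (X∩-X≡∅ y y∈X) y ⟩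
        𝟙 (lookup X y)                                                          ≡⟨ cong 𝟙 (∈⇒lookup≡true y∈X) ⟩
        1                                                                       ∎)
        where open ≡-Reasoning

      doubling : ∀ {y} → y ∈ X → ∃ λ y′ → y′ ∈ X × ⟦ y′ ⟧ ≈± + 2 ℤ.* ⟦ y ⟧
      doubling {y} y∈X =
        [ (λ eq → negₙ n y +ₙ negₙ n y , lookup≡true⇒∈ eq , inj₂ (⟦-ₙi+ₙ-ₙi⟧ y))
        , (λ eq → _⊖_ n y (negₙ n y) , lookup≡true⇒∈ eq , inj₁ (⟦i⊖-ₙi⟧ y))
        ]′ (±2y∈X y∈X)

      powers-of-two : ∀ {x} → x ∈ X → ∀ j → ∃ λ y → y ∈ X × ⟦ y ⟧ ≈± + (2 ^ j) ℤ.* ⟦ x ⟧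
      powers-of-two {x} x∈X ℕ.zero    = x , x∈X , inj₁ (≈-reflexive (sym (ℤP.*-identityˡ ⟦ x ⟧)))
      powers-of-two {x} x∈X (ℕ.suc j) =
        let (y , y∈X , y≈±2ʲx)    = powers-of-two x∈X j
            (y′ , y′∈X , y′≈±2y) = doubling y∈X
        in y′ , y′∈X , ≈±-trans y′≈±2y (≈±-trans (≈±-*-congˡ (+ 2) y≈±2ʲx) (inj₁ (≈-reflexive 2[2ʲx]≡2ʲ⁺¹x)))
        where
          2[2ʲx]≡2ʲ⁺¹x : + 2 ℤ.* (+ (2 ^ j) ℤ.* ⟦ x ⟧) ≡ + (2 ^ ℕ.suc j) ℤ.* ⟦ x ⟧
          2[2ʲx]≡2ʲ⁺¹x = trans (sym (ℤP.*-assoc (+ 2) (+ (2 ^ j)) ⟦ x ⟧)) (cong (ℤ._* ⟦ x ⟧) (sym (ℤP.pos-* 2 (2 ^ j))))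

      n≢2ʲ : ∀ j → n ≢ 2 ^ j
      n≢2ʲ j n≡2ʲ =
        let (x , x∈X)         = X-nonempty dsrg
            (y , y∈X , y≈±2ʲx) = powers-of-two x∈X j
            2ʲx≈0 : + (2 ^ j) ℤ.* ⟦ x ⟧ ≈ 0ℤ
            2ʲx≈0 = subst (λ m → + m ℤ.* ⟦ x ⟧ ≈ 0ℤ) n≡2ʲ (n*a≈0 ⟦ x ⟧)
        in 0∉X (subst (_∈ X) (⟦⟧-injective (≈-trans (≈±-≈0 y≈±2ʲx 2ʲx≈0) (≈-sym ⟦0ₙ⟧))) y∈X)

lemma6p2 : (α : ℕ) → 1 ≤ α → (X : Subset (2 ^ α)) →
    0ₙ (2 ^ α) {{m^n≢0 2 α}} ∉ X →
    (∀ (i : Fin (2 ^ α)) → i ∈ X → negₙ (2 ^ α) {{m^n≢0 2 α}} i ∉ X) →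
    ¬ DihIsDSRG (2 ^ α) {{m^n≢0 2 α}} X X
lemma6p2 α _ X 0∉X X∩-X≡∅ (_ , _ , _ , _ , _ , dsrg) =
  DihedralCayley.n≢2ʲ (2 ^ α) {{m^n≢0 2 α}} X X∩-X≡∅ 0∉X dsrg α refl
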